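{- There is an absolute constant $C>0$ such that every caterpillar $T$ on $n$ vertices satisfies $\mathcal{AC}(T)\le Cn$.
   Context: A caterpillar is a tree in which every vertex lies on, or is adjacent to, a single path (the spine). Acquaintance time: on a finite connected graph $G$, one agent is initially placed on each vertex; two agents become (permanently) acquainted whenever they occupy adjacent vertices at some point (including at the start). In each round one chooses a matching of $G$ and swaps the agents at the endpoints of each matching edge. $\mathcal{AC}(G)$ is the minimum number of rounds until all pairs of agents are acquainted. -}

module Defs where

open import Data.Nat using (ℕ; _≤_; _<_; _*_)
open import Data.Fin using (Fin)
open import Data.List using (List; []; _∷_; _∷ʳ_; length)
open import Data.List.Relation.Unary.All using (All)
open import Data.List.Relation.Unary.Any using (Any)
open import Data.List.Relation.Unary.Unique.Propositional using (Unique)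
open import Data.Product using (Σ; ∃; ∃₂; _×_; _,_)
open import Data.Sum using (_⊎_)
open import Relation.Binary.PropositionalEquality using (_≡_; _≢_)
open import Relation.Binary.Core using (Rel)
open import Relation.Binary.Definitions using (Decidable)
open import Relation.Nullary using (¬_)
open import Level using (0ℓ)

record Graph (n : ℕ) : Set₁ where
  field
    Adj    : Rel (Fin n) 0ℓ
    adj?   : Decidable Adj
    sym    : ∀ {u v} → Adj u v → Adj v u
    irrefl : ∀ {v} → ¬ Adj v v

module _ {n : ℕ} (G : Graph n) where
  open Graph G

  data Walk : Fin n → Fin n → Set where
    here : ∀ {u} → Walk u u
    step : ∀ {u w v} → Adj u w → Walk w v → Walk u v

  Connected : Set
  Connected = ∀ u v → Walk u v

  Chain : List (Fin n) → Set
  Chain []           = Data.Unit.⊤ where import Data.Unit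
  Chain (x ∷ [])     = Data.Unit.⊤ where import Data.Unit
  Chain (x ∷ y ∷ xs) = Adj x y × Chain (y ∷ xs)

  IsCycle : Fin n → List (Fin n) → Set
  IsCycle x xs = 2 ≤ length xs × Unique (x ∷ xs) × Chain ((x ∷ xs) ∷ʳ x)

  Acyclic : Set
  Acyclic = ∀ x xs → ¬ IsCycle x xs

  IsTree : Set
  IsTree = Connected × Acyclic

  IsPath : List (Fin n) → Set
  IsPath xs = Unique xs × Chain xs

  IsCaterpillar : Set
  IsCaterpillar = IsTree × Σ (List (Fin n)) λ spine →
    IsPath spine × (∀ v → Any (λ s → v ≡ s ⊎ Adj v s) spine)

  -- A matching, encoded as an involution m with m v = v meaning v unmatched
  -- and otherwise {v , m v} an edge of G.
  IsMatching : (Fin n → Fin n) → Set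
  IsMatching m = (∀ v → m (m v) ≡ v) × (∀ v → m v ≢ v → Adj v (m v))

  -- configurations: σ v = agent on vertex v. Swapping along matching m
  -- gives σ ∘ m.  states σ ms = list of configurations at times 0,…,length ms.
  states : (Fin n → Fin n) → List (Fin n → Fin n) → List (Fin n → Fin n)
  states σ []       = σ ∷ []
  states σ (m ∷ ms) = σ ∷ states (λ v → σ (m v)) ms

  -- agents a and b are acquainted at some time of the process
  -- (agents are labelled by their initial vertex; initial configuration id)
  Acquainted : List (Fin n → Fin n) → Fin n → Fin n → Set
  Acquainted ms a b = Any (λ σ → ∃₂ λ u v → Adj u v × σ u ≡ a × σ v ≡ b)
                          (states (λ v → v) ms)

  AcquaintingStrategy : List (Fin n → Fin n) → Set
  AcquaintingStrategy ms = All IsMatching ms × (∀ a b → a ≢ b → Acquainted ms a b)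

  ACAtMost : ℕ → Set
  ACAtMost k = Σ (List (Fin n → Fin n)) λ ms → length ms ≤ k × AcquaintingStrategy ms

module Submission where

-- Let the spine have k vertices. Zigzag rounds alternately match the spine
-- edges starting at even and at odd positions; under them an agent on the spine
-- travels back and forth, so within 2k rounds it passes every spine vertex, and
-- hence is adjacent to every leg, and becomes adjacent to every other spine agent.
-- The strategy runs in cycles of 6k rounds and keeps the set of pending agents,
-- those not yet known to have met everybody. In the first 4k rounds of a cycle
-- zigzag rounds alternate with exchanges in which a spine vertex holding a
-- settled agent swaps it with a pending agent on one of its legs. A slot moving
-- with the zigzag keeps a pending agent once it has one, and takes one from
-- every leg it passes that still has one; as every slot passes every spine
-- vertex, afterwards either all spine vertices hold pending agents or no leg
-- does. The last 2k rounds are zigzag rounds, after which the spine agents are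
-- settled: the pending set loses k agents or becomes empty. Thus ⌊n / k⌋ + 1
-- cycles, at most 6(n + k) ≤ 12n rounds, suffice.

open import Defs
open import Data.Bool using (Bool; true; false; not; _∧_; _xor_; if_then_else_)
import Data.Bool as Bool
open import Data.Bool.Properties using (not-involutive; not-injective; xor-same; ¬-not; ∧-zeroʳ)
open import Data.Empty using (⊥-elim)
open import Data.Fin using (Fin; zero; suc; _≟_; punchIn)
open import Data.Fin.Properties using (punchInᵢ≢i; any?)
open import Data.List using (List; []; _∷_; _++_; length)
open import Data.List.Properties using (length-++)
open import Data.List.Relation.Unary.All using (All; []; _∷_)
open import Data.List.Relation.Unary.All.Properties using (++⁺)
open import Data.List.Relation.Unary.AllPairs using (AllPairs; _∷_)
open import Data.List.Relation.Unary.Any using (Any; here; there)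
open import Data.Maybe using (Maybe; just; nothing; fromMaybe)
import Data.Maybe.Properties as Maybe
open import Data.Nat using (ℕ; zero; suc; pred; _+_; _*_; _∸_; _≤_; _<_; _<?_; _≤?_; z≤n; s≤s)
import Data.Nat as ℕ
open import Data.Nat.DivMod using (_/_; _%_; m≡m%n+[m/n]*n; m%n<n; m/n*n≤m)
open import Data.Nat.Properties hiding (_≟_)
open import Data.Nat.Tactic.RingSolver using (solve-∀)
open import Algebra.Properties.CommutativeMonoid.Sum +-0-commutativeMonoid
  using (sum; sum-cong-≗; sum-replicate-zero; sum-remove; ∑-distrib-+)
open import Data.Product using (Σ; ∃; ∃₂; _×_; _,_; proj₁; proj₂)
open import Data.Sum using (_⊎_; inj₁; inj₂)
open import Function using (_∘_; id; case_of_)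
open import Function.Definitions using (Injective)
open import Relation.Binary.Definitions using (tri<; tri≈; tri>)
open import Relation.Binary.PropositionalEquality
open import Relation.Nullary using (¬_; ¬?; Dec; yes; no; does; _×-dec_; contradiction)

even : ℕ → Bool
even zero    = true
even (suc p) = not (even p)

-- odd–even transposition rounds on the path with positions 0, …, k'
module Zigzag (k' : ℕ) where

  k : ℕ
  k = suc k'

  right : ℕ → ℕ
  right p with suc p <? k
  ... | yes _ = suc p
  ... | no  _ = p

  -- The round of parity b matches positions p and p + 1 when even p ≡ b;
  -- the ends of the path may be left unmatched.
  partner : Bool → ℕ → ℕ
  partner b p = if even p xor b then pred p else right p

  partner-right : ∀ b p → even p ≡ b → partner b p ≡ right p
  partner-right b p refl rewrite xor-same (even p) = refl

  partner-pred : ∀ b p → even p ≡ not b → partner b p ≡ pred p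
  partner-pred true  p e rewrite e = refl
  partner-pred false p e rewrite e = refl

  Adjacent : ℕ → ℕ → Set
  Adjacent p q = suc p ≡ q ⊎ suc q ≡ p

  partner-neighbour : ∀ b p → Adjacent p (partner b p) ⊎ partner b p ≡ p
  partner-neighbour b p with even p xor b
  ... | false with suc p <? k
  ...   | yes _ = inj₁ (inj₁ refl)
  ...   | no  _ = inj₂ refl
  partner-neighbour b zero    | true = inj₂ refl
  partner-neighbour b (suc q) | true = inj₁ (inj₂ refl)

  -- A walker is a position moving with the zigzag rounds: it heads right (true)
  -- or left (false), and at an end of the path it spends one round turning.
  Walker : Set
  Walker = Bool × ℕ

  position : Walker → ℕ
  position = proj₂

  move : Walker → Walker
  move (true , p) with suc p <? k
  ... | yes _ = true , suc p
  ... | no  _ = false , p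
  move (false , zero)  = true , zero
  move (false , suc p) = false , p

  moves : ℕ → Walker → Walker
  moves zero    w = w
  moves (suc t) w = moves t (move w)

  -- in the round of parity b the walker moves in its heading
  Synced : Bool → Walker → Set
  Synced b (true  , p) = even p ≡ b
  Synced b (false , p) = even p ≡ not b

  synced-heading : ∀ b p → ∃ λ d → Synced b (d , p)
  synced-heading b p with even p in e
  synced-heading true  p | true  = true  , e
  synced-heading true  p | false = false , e
  synced-heading false p | true  = false , e
  synced-heading false p | false = true  , e

  partner-move : ∀ b w → Synced b w → partner b (position w) ≡ position (move w)
  partner-move b (true , p) e rewrite partner-right b p e with suc p <? k
  ... | yes _ = refl
  ... | no  _ = refl
  partner-move b (false , zero)  e = partner-pred b zero e
  partner-move b (false , suc p) e = partner-pred b (suc p) e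

  move-synced : ∀ b w → Synced b w → Synced (not b) (move w)
  move-synced b (true , p) e with suc p <? k
  ... | yes _ = cong not e
  ... | no  _ = trans e (sym (not-involutive b))
  move-synced b (false , zero)  e = e
  move-synced b (false , suc p) e = trans (not-injective e) (sym (not-involutive b))

  move-< : ∀ w → position w < k → position (move w) < k
  move-< (true , p) h with suc p <? k
  ... | yes h' = h'
  ... | no  _  = h
  move-< (false , zero)  h = h
  move-< (false , suc p) h = <-trans (n<1+n p) h

  moves-< : ∀ t w → position w < k → position (moves t w) < k
  moves-< zero    w h = h
  moves-< (suc t) w h = moves-< t (move w) (move-< w h)

  partner-< : ∀ b p → p < k → partner b p < k
  partner-< b p h with synced-heading b p
  ... | d , s rewrite partner-move b (d , p) s = move-< (d , p) h

  turn : Walker → Walker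
  turn (d , p) = not d , p

  turn-synced : ∀ b w → Synced (not b) w → Synced b (turn w)
  turn-synced b (true  , p) e = e
  turn-synced b (false , p) e = trans e (not-involutive b)

  move-turn-move : ∀ w → position w < k → move (turn (move w)) ≡ turn w
  move-turn-move (true , p) h with suc p <? k
  move-turn-move (true , p) h | yes _ with p <? k
  ... | yes _  = refl
  ... | no  ¬h = ⊥-elim (¬h h)
  move-turn-move (true , p) h | no ¬h with suc p <? k
  ... | yes h' = ⊥-elim (¬h h')
  ... | no  _  = refl
  move-turn-move (false , zero) h with 1 <? k
  ... | yes _ = refl
  ... | no  _ = refl
  move-turn-move (false , suc p) h with suc p <? k
  ... | yes _  = refl
  ... | no  ¬h = ⊥-elim (¬h h)

  -- Turning around retraces the last move, so each round is an involution.
  partner-involutive : ∀ b p → p < k → partner b (partner b p) ≡ p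
  partner-involutive b p h with synced-heading b p
  ... | d , s = begin
    partner b (partner b p)              ≡⟨ cong (partner b) (partner-move b w s) ⟩
    partner b (position (move w))        ≡⟨ partner-move b (turn (move w)) (turn-synced b _ (move-synced b w s)) ⟩
    position (move (turn (move w)))      ≡⟨ cong position (move-turn-move w h) ⟩
    p                                    ∎
    where
      open ≡-Reasoning
      w = d , p

  partner-injective : ∀ b p q → p < k → q < k → partner b p ≡ partner b q → p ≡ q
  partner-injective b p q hp hq e =
    trans (sym (partner-involutive b p hp)) (trans (cong (partner b) e) (partner-involutive b q hq))

  partner≤suc : ∀ b p → partner b p ≤ suc p
  partner≤suc b p with partner-neighbour b p
  ... | inj₁ (inj₁ e) = ≤-reflexive (sym e)
  ... | inj₁ (inj₂ e) = ≤-trans (n≤1+n _) (≤-trans (≤-reflexive e) (n≤1+n p))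
  ... | inj₂ e        = m≤n⇒m≤1+n (≤-reflexive e)

  ≤suc-partner : ∀ b p → p ≤ suc (partner b p)
  ≤suc-partner b p with partner-neighbour b p
  ... | inj₁ (inj₁ e) = ≤-trans (n≤1+n p) (≤-trans (≤-reflexive e) (n≤1+n _))
  ... | inj₁ (inj₂ e) = ≤-reflexive (sym e)
  ... | inj₂ e        = m≤n⇒m≤1+n (≤-reflexive (sym e))

  moves-+ : ∀ s t w → moves (s + t) w ≡ moves t (moves s w)
  moves-+ zero    t w = refl
  moves-+ (suc s) t w = moves-+ s t (move w)

  moves-suc : ∀ t w → moves (suc t) w ≡ move (moves t w)
  moves-suc zero    w = refl
  moves-suc (suc t) w = moves-suc t (move w)

  within-lap : ∀ {t} → t ≤ k' → t < k + k
  within-lap t≤k' = <-≤-trans (s≤s t≤k') (m≤m+n k k)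

  moves-right : ∀ d p → p + d < k → moves d (true , p) ≡ (true , p + d)
  moves-right zero    p h = cong (true ,_) (sym (+-identityʳ p))
  moves-right (suc d) p h with suc p <? k
  ... | yes _  = trans (moves-right d (suc p) (subst (_< k) (+-suc p d) h)) (cong (true ,_) (sym (+-suc p d)))
  ... | no  ¬h = ⊥-elim (¬h (≤-<-trans (s≤s (m≤m+n p d)) (subst (_< k) (+-suc p d) h)))

  moves-left : ∀ d p → d ≤ p → moves d (false , p) ≡ (false , p ∸ d)
  moves-left zero    p       h       = refl
  moves-left (suc d) (suc p) (s≤s h) = moves-left d p h

  reach-right : ∀ p j → p ≤ j → j ≤ k' → moves (j ∸ p) (true , p) ≡ (true , j)
  reach-right p j p≤j j≤k' =
    trans (moves-right (j ∸ p) p (s≤s (≤-trans (≤-reflexive e) j≤k'))) (cong (true ,_) e)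
    where e = m+[n∸m]≡n p≤j

  reach-left : ∀ j p → j ≤ p → moves (p ∸ j) (false , p) ≡ (false , j)
  reach-left j p j≤p = trans (moves-left (p ∸ j) p (m∸n≤m p j)) (cong (false ,_) (m∸[m∸n]≡n j≤p))

  move-at-right-end : move (true , k') ≡ (false , k')
  move-at-right-end with suc k' <? k
  ... | yes h = ⊥-elim (<-irrefl refl h)
  ... | no  _ = refl

  moves-via : ∀ s t w {v} → moves s w ≡ v → moves (s + t) w ≡ moves t v
  moves-via s t w e = trans (moves-+ s t w) (cong (moves t) e)

  origin : Walker
  origin = true , zero

  bounce-right : ∀ p j → p ≤ k' → j ≤ k' → moves ((k' ∸ p) + suc (k' ∸ j)) (true , p) ≡ (false , j)
  bounce-right p j hp hj = begin
    moves ((k' ∸ p) + suc (k' ∸ j)) (true , p)  ≡⟨ moves-via (k' ∸ p) _ _ (reach-right p k' hp ≤-refl) ⟩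
    moves (k' ∸ j) (move (true , k'))           ≡⟨ cong (moves (k' ∸ j)) move-at-right-end ⟩
    moves (k' ∸ j) (false , k')                 ≡⟨ reach-left j k' hj ⟩
    (false , j)                                 ∎
    where open ≡-Reasoning

  bounce-left : ∀ p j → j ≤ k' → moves (p + suc j) (false , p) ≡ (true , j)
  bounce-left p j hj = trans (moves-via p (suc j) _ (reach-left 0 p z≤n)) (reach-right 0 j z≤n hj)

  half-lap : moves k origin ≡ (false , k')
  half-lap = trans (moves-suc k' origin) (trans (cong move (reach-right 0 k' z≤n ≤-refl)) move-at-right-end)

  other-half-lap : moves k (false , k') ≡ origin
  other-half-lap = trans (moves-suc k' _) (cong move (reach-left 0 k' z≤n))

  reachable : ∀ w → position w < k → ∃ λ t → moves t origin ≡ w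
  reachable (true  , p) (s≤s h) = p , reach-right 0 p z≤n h
  reachable (false , p) (s≤s h) = k + (k' ∸ p) , trans (moves-via k (k' ∸ p) origin half-lap) (reach-left p k' h)

  moves-period : ∀ w → position w < k → moves (k + k) w ≡ w
  moves-period w h with reachable w h
  ... | t , refl = begin
    moves (k + k) (moves t origin)      ≡⟨ moves-+ t (k + k) origin ⟨
    moves (t + (k + k)) origin          ≡⟨ cong (λ z → moves z origin) (+-comm t (k + k)) ⟩
    moves ((k + k) + t) origin          ≡⟨ moves-via (k + k) t origin (moves-via k k origin half-lap) ⟩
    moves t (moves k (false , k'))      ≡⟨ cong (moves t) other-half-lap ⟩
    moves t origin                      ∎
    where open ≡-Reasoning

  visits : ∀ w → position w < k → ∀ j → j < k → ∃ λ t → t < k + k × position (moves t w) ≡ j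
  visits (true , p) (s≤s hp) j (s≤s hj) with p ≤? j
  ... | yes p≤j = j ∸ p , within-lap (≤-trans (m∸n≤m j p) hj) , cong position (reach-right p j p≤j hj)
  ... | no  _   = (k' ∸ p) + suc (k' ∸ j) , s≤s (+-mono-≤ (m∸n≤m k' p) (s≤s (m∸n≤m k' j))) ,
                  cong position (bounce-right p j hp hj)
  visits (false , p) (s≤s hp) j (s≤s hj) with j ≤? p
  ... | yes j≤p = p ∸ j , within-lap (≤-trans (m∸n≤m p j) hp) , cong position (reach-left j p j≤p)
  ... | no  _   = p + suc j , s≤s (+-mono-≤ hp (s≤s hj)) , cong position (bounce-left p j hj)

  Distinct : Walker → Walker → Set
  Distinct v w = position v ≢ position w

  move-distinct : ∀ b v w → Synced b v → Synced b w → position v < k → position w < k →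
                  Distinct v w → Distinct (move v) (move w)
  move-distinct b v w sv sw hv hw ne e =
    ne (partner-injective b _ _ hv hw (trans (partner-move b v sv) (trans e (sym (partner-move b w sw)))))

  -- Walkers never collide: the rounds are matchings.
  moves-distinct : ∀ t b v w → Synced b v → Synced b w → position v < k → position w < k →
                   Distinct v w → Distinct (moves t v) (moves t w)
  moves-distinct zero    b v w sv sw hv hw ne = ne
  moves-distinct (suc t) b v w sv sw hv hw ne =
    moves-distinct t (not b) (move v) (move w) (move-synced b v sv) (move-synced b w sw)
      (move-< v hv) (move-< w hw) (move-distinct b v w sv sw hv hw ne)

  -- Positions change by at most one per round, so walkers that swap order were adjacent.
  swap-adjacent : ∀ b v w → Synced b v → Synced b w → position v < position w →
                  position (move w) < position (move v) → suc (position v) ≡ position w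
  swap-adjacent b v w sv sw v<w w'<v'
    rewrite sym (partner-move b v sv) | sym (partner-move b w sw) =
    ≤-antisym v<w (≤-trans (≤suc-partner b (position w)) (≤-trans w'<v' (partner≤suc b (position v))))

  crossing-adjacent : ∀ T b v w → Synced b v → Synced b w → position v < k → position w < k →
                      position v < position w → position (moves T w) < position (moves T v) →
                      ∃ λ t → t < T × suc (position (moves t v)) ≡ position (moves t w)
  crossing-adjacent zero    b v w sv sw hv hw v<w w<v = ⊥-elim (<-asym v<w w<v)
  crossing-adjacent (suc T) b v w sv sw hv hw v<w wT<vT
    with <-cmp (position (move v)) (position (move w))
  ... | tri> _ _ w'<v' = 0 , s≤s z≤n , swap-adjacent b v w sv sw v<w w'<v'
  ... | tri≈ _ e _     = ⊥-elim (move-distinct b v w sv sw hv hw (<⇒≢ v<w) e)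
  ... | tri< v'<w' _ _ with crossing-adjacent T (not b) (move v) (move w) (move-synced b v sv)
                              (move-synced b w sw) (move-< v hv) (move-< w hw) v'<w' wT<vT
  ...   | t , t<T , e = suc t , s≤s t<T , e

  -- Two walkers become adjacent within one lap: follow the first to the end of
  -- the path lying beyond the second; on the way they must cross.
  walkers-meet : ∀ b v w → Synced b v → Synced b w → position v < k → position w < k →
                 Distinct v w → ∃ λ t → t < k + k × Adjacent (position (moves t v)) (position (moves t w))
  walkers-meet b v w sv sw hv hw ne with <-cmp (position v) (position w)
  ... | tri≈ _ e _ = ⊥-elim (ne e)
  ... | tri< v<w _ _ with visits v hv k' ≤-refl
  ...   | T , T<2k , vT with crossing-adjacent T b v w sv sw hv hw v<w
                           (subst (position (moves T w) <_) (sym vT)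
                             (≤∧≢⇒< (≤-pred (moves-< T w hw)) λ e → apart (trans vT (sym e))))
    where apart = moves-distinct T b v w sv sw hv hw ne
  ...     | t , t<T , e = t , <-trans t<T T<2k , inj₁ e
  walkers-meet b v w sv sw hv hw ne | tri> _ _ w<v with visits v hv 0 (s≤s z≤n)
  ...   | T , T<2k , vT with crossing-adjacent T b w v sw sv hw hv w<v
                           (subst (_< position (moves T w)) (sym vT)
                             (n≢0⇒n>0 λ e → apart (trans vT (sym e))))
    where apart = moves-distinct T b v w sv sw hv hw ne
  ...     | t , t<T , e = t , <-trans t<T T<2k , inj₂ e

fromBool : Bool → ℕ
fromBool true  = 1
fromBool false = 0

count : ∀ {n} → (Fin n → Bool) → ℕ
count f = sum (λ a → fromBool (f a))

count≤n : ∀ {n} (f : Fin n → Bool) → count f ≤ n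
count≤n {zero}  f = z≤n
count≤n {suc n} f = +-mono-≤ (bound (f zero)) (count≤n (λ a → f (suc a)))
  where
    bound : ∀ b → fromBool b ≤ 1
    bound true  = s≤s z≤n
    bound false = z≤n

count-none : ∀ {n} (f : Fin n → Bool) → (∀ a → f a ≡ false) → count f ≡ 0
count-none {n} f none = trans (sum-cong-≗ (λ a → cong fromBool (none a))) (sum-replicate-zero n)

count≡0⇒none : ∀ {n} (f : Fin n → Bool) → count f ≡ 0 → ∀ a → f a ≡ false
count≡0⇒none {suc n} f c zero with f zero
... | false = refl
count≡0⇒none {suc n} f c (suc a) = count≡0⇒none (λ a → f (suc a)) (m+n≡0⇒n≡0 (fromBool (f zero)) c) a

count-point : ∀ {n} (c : Fin n) → count (λ a → does (c ≟ a)) ≡ 1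
count-point {suc n} c = begin
  count (λ a → does (c ≟ a))                              ≡⟨ sum-remove {i = c} t ⟩
  fromBool (does (c ≟ c)) + sum (λ j → t (punchIn c j))  ≡⟨ cong₂ _+_ hit (count-none _ miss) ⟩
  1                                                       ∎
  where
    open ≡-Reasoning
    t = λ a → fromBool (does (c ≟ a))
    hit : fromBool (does (c ≟ c)) ≡ 1
    hit with c ≟ c
    ... | yes _  = refl
    ... | no c≢c = ⊥-elim (c≢c refl)
    miss : ∀ j → does (c ≟ punchIn c j) ≡ false
    miss j with c ≟ punchIn c j
    ... | yes e = ⊥-elim (punchInᵢ≢i c j (sym e))
    ... | no  _ = refl

count-remove : ∀ {n} (f g : Fin n → Bool) → (∀ a → g a ≡ true → f a ≡ true) →
               count f ≡ count (λ a → f a ∧ not (g a)) + count g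
count-remove f g g⊆f =
  trans (sum-cong-≗ split) (∑-distrib-+ (λ a → fromBool (f a ∧ not (g a))) (fromBool ∘ g))
  where
    split : ∀ a → fromBool (f a) ≡ fromBool (f a ∧ not (g a)) + fromBool (g a)
    split a with g a in e
    ... | true  rewrite g⊆f a e = refl
    ... | false with f a
    ...   | true  = refl
    ...   | false = refl

InjectiveBelow : ∀ {A : Set} → ℕ → (ℕ → A) → Set
InjectiveBelow m h = ∀ {p q} → p < m → q < m → h p ≡ h q → p ≡ q

inImage? : ∀ {n} (h : ℕ → Fin n) m a → Dec (∃ λ q → q < m × h q ≡ a)
inImage? h m a = anyUpTo? (λ q → h q ≟ a) m

inImage : ∀ {n} → (ℕ → Fin n) → ℕ → Fin n → Bool
inImage h m a = does (inImage? h m a)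

count-image : ∀ {n} (h : ℕ → Fin n) m → InjectiveBelow m h → count (inImage h m) ≡ m
count-image h zero    inj = count-none (inImage h zero) (λ a → refl)
count-image h (suc m) inj = begin
  count (inImage h (suc m))
    ≡⟨ sum-cong-≗ split ⟩
  sum (λ a → fromBool (hit a) + fromBool (inImage h m a))
    ≡⟨ ∑-distrib-+ (fromBool ∘ hit) (fromBool ∘ inImage h m) ⟩
  count hit + count (inImage h m)
    ≡⟨ cong₂ _+_ (count-point (h m)) (count-image h m inj<m) ⟩
  suc m
    ∎
  where
    open ≡-Reasoning
    hit = λ a → does (h m ≟ a)
    inj<m : InjectiveBelow m h
    inj<m p<m q<m = inj (m≤n⇒m≤1+n p<m) (m≤n⇒m≤1+n q<m)
    split : ∀ a → fromBool (inImage h (suc m) a) ≡ fromBool (hit a) + fromBool (inImage h m a)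
    split a with h m ≟ a | inImage? h m a
    ... | yes e | yes (q , q<m , e′) =
      ⊥-elim (<-irrefl (inj (m≤n⇒m≤1+n q<m) ≤-refl (trans e′ (sym e))) q<m)
    ... | yes _ | no  _ = refl
    ... | no  _ | yes _ = refl
    ... | no  _ | no  _ = refl

Config : ℕ → Set
Config n = Fin n → Fin n

run : ∀ {n} → Config n → List (Config n) → Config n
run σ []       = σ
run σ (m ∷ ms) = run (σ ∘ m) ms

module _ {n : ℕ} (G : Graph n) where
  open Graph G using (Adj)

  Meet : Config n → Fin n → Fin n → Set
  Meet σ a b = ∃₂ λ u v → Adj u v × σ u ≡ a × σ v ≡ b

  MeetDuring : Config n → List (Config n) → Fin n → Fin n → Set
  MeetDuring σ ms a b = Any (λ τ → Meet τ a b) (states G σ ms)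

  states-++⁺ˡ : ∀ {P : Config n → Set} σ xs ys →
                Any P (states G σ xs) → Any P (states G σ (xs ++ ys))
  states-++⁺ˡ σ []       []      p          = p
  states-++⁺ˡ σ []       (_ ∷ _) (here p)   = here p
  states-++⁺ˡ σ (m ∷ xs) ys      (here p)   = here p
  states-++⁺ˡ σ (m ∷ xs) ys      (there ps) = there (states-++⁺ˡ (σ ∘ m) xs ys ps)

  states-++⁺ʳ : ∀ {P : Config n → Set} σ xs ys →
                Any P (states G (run σ xs) ys) → Any P (states G σ (xs ++ ys))
  states-++⁺ʳ σ []       ys ps = ps
  states-++⁺ʳ σ (m ∷ xs) ys ps = there (states-++⁺ʳ (σ ∘ m) xs ys ps)

  IsPermutation : Config n → Set
  IsPermutation σ = Injective _≡_ _≡_ σ × (∀ a → ∃ λ v → σ v ≡ a)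

  id-permutation : IsPermutation id
  id-permutation = (λ e → e) , λ a → a , refl

  run-permutation : ∀ σ ms → All (IsMatching G) ms → IsPermutation σ → IsPermutation (run σ ms)
  run-permutation σ ms ok (inj , surj) = run-injective σ ms ok inj , λ a → trace ms (proj₁ (surj a)) ,
    trans (run-trace σ ms ok (proj₁ (surj a))) (proj₂ (surj a))
    where
      -- the vertex holding, after the rounds ms, what started on vertex a
      trace : List (Config n) → Fin n → Fin n
      trace []       a = a
      trace (m ∷ ms) a = trace ms (m a)

      run-trace : ∀ σ ms → All (IsMatching G) ms → ∀ a → run σ ms (trace ms a) ≡ σ a
      run-trace σ []       []                 a = refl
      run-trace σ (m ∷ ms) ((invol , _) ∷ ok) a = trans (run-trace (σ ∘ m) ms ok (m a)) (cong σ (invol a))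

      run-injective : ∀ σ ms → All (IsMatching G) ms →
                      Injective _≡_ _≡_ σ → Injective _≡_ _≡_ (run σ ms)
      run-injective σ []       []                 inj = inj
      run-injective σ (m ∷ ms) ((invol , _) ∷ ok) inj = run-injective (σ ∘ m) ms ok
        λ {u} {v} e → trans (sym (invol u)) (trans (cong m (inj e)) (invol v))

module Caterpillar {n : ℕ} (G : Graph n) (k' : ℕ) (spine : ℕ → Fin n)
  (spine-adj : ∀ {p} → suc p < suc k' → Graph.Adj G (spine p) (spine (suc p)))
  (spine-inj : InjectiveBelow (suc k') spine)
  (spine-dominates : ∀ v → ∃ λ p → p < suc k' × (v ≡ spine p ⊎ Graph.Adj G v (spine p))) where

  open Graph G using (Adj) renaming (sym to Adj-sym)
  open Zigzag k'

  OnSpine : Fin n → Set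
  OnSpine v = ∃ λ p → p < k × spine p ≡ v

  onSpine? : ∀ v → Dec (OnSpine v)
  onSpine? = inImage? spine k

  foot : Fin n → ℕ
  foot v = proj₁ (spine-dominates v)

  foot< : ∀ v → foot v < k
  foot< v = proj₁ (proj₂ (spine-dominates v))

  leg-adj : ∀ v → ¬ OnSpine v → Adj v (spine (foot v))
  leg-adj v leg with spine-dominates v
  ... | p , p<k , inj₁ e = ⊥-elim (leg (p , p<k , sym e))
  ... | p , p<k , inj₂ a = a

  adjacent-spine : ∀ p q → p < k → q < k → Adjacent p q → Adj (spine p) (spine q)
  adjacent-spine p q p<k q<k (inj₁ refl) = spine-adj q<k
  adjacent-spine p q p<k q<k (inj₂ refl) = Adj-sym (spine-adj p<k)

  partner-adj : ∀ b p → p < k → partner b p ≢ p → Adj (spine p) (spine (partner b p))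
  partner-adj b p h moved with partner-neighbour b p
  ... | inj₁ adjacent = adjacent-spine p _ h (partner-< b p h) adjacent
  ... | inj₂ e        = ⊥-elim (moved e)

  zig : Bool → Fin n → Fin n
  zig b v with onSpine? v
  ... | yes (p , _ , _) = spine (partner b p)
  ... | no  _           = v

  zig-spine : ∀ b p → p < k → zig b (spine p) ≡ spine (partner b p)
  zig-spine b p h with onSpine? (spine p)
  ... | yes (p′ , h′ , e) rewrite spine-inj h′ h e = refl
  ... | no  leg = ⊥-elim (leg (p , h , refl))

  zig-leg : ∀ b v → ¬ OnSpine v → zig b v ≡ v
  zig-leg b v leg with onSpine? v
  ... | yes s = ⊥-elim (leg s)
  ... | no  _ = refl

  zig-matching : ∀ b → IsMatching G (zig b)
  zig-matching b = invol , adj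
    where
      invol : ∀ v → zig b (zig b v) ≡ v
      invol v with onSpine? v
      ... | yes (p , h , refl) =
        trans (zig-spine b (partner b p) (partner-< b p h)) (cong spine (partner-involutive b p h))
      ... | no  leg            = zig-leg b v leg
      adj : ∀ v → zig b v ≢ v → Adj v (zig b v)
      adj v moved with onSpine? v
      ... | yes (p , h , refl) = partner-adj b p h (moved ∘ cong spine)
      ... | no  _              = ⊥-elim (moved refl)

  zig-move : ∀ b w → Synced b w → position w < k → zig b (spine (position (move w))) ≡ spine (position w)
  zig-move b w s h = trans (zig-spine b _ (move-< w h))
    (cong spine (trans (cong (partner b) (sym (partner-move b w s))) (partner-involutive b (position w) h)))

  ValidChoice : (ℕ → Maybe (Fin n)) → Set
  ValidChoice choice = ∀ p l → choice p ≡ just l → ¬ OnSpine l × foot l ≡ p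

  module Exchange (choice : ℕ → Maybe (Fin n)) (valid : ValidChoice choice) where

    chosen? : ∀ v → Dec (choice (foot v) ≡ just v)
    chosen? v = Maybe.≡-dec _≟_ (choice (foot v)) (just v)

    exchange : Fin n → Fin n
    exchange v with onSpine? v
    ... | yes (p , _ , _) = fromMaybe v (choice p)
    ... | no  _ with chosen? v
    ...   | yes _ = spine (foot v)
    ...   | no  _ = v

    exchange-spine : ∀ p → p < k → exchange (spine p) ≡ fromMaybe (spine p) (choice p)
    exchange-spine p h with onSpine? (spine p)
    ... | yes (p′ , h′ , e) rewrite spine-inj h′ h e = refl
    ... | no  leg = ⊥-elim (leg (p , h , refl))

    exchange-chosen : ∀ v → ¬ OnSpine v → choice (foot v) ≡ just v → exchange v ≡ spine (foot v)
    exchange-chosen v leg c with onSpine? v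
    ... | yes s = ⊥-elim (leg s)
    ... | no  _ with chosen? v
    ...   | yes _ = refl
    ...   | no  ¬c = ⊥-elim (¬c c)

    exchange-unchosen : ∀ v → ¬ OnSpine v → choice (foot v) ≢ just v → exchange v ≡ v
    exchange-unchosen v leg ¬c with onSpine? v
    ... | yes s = ⊥-elim (leg s)
    ... | no  _ with chosen? v
    ...   | yes c = ⊥-elim (¬c c)
    ...   | no  _ = refl

    exchange-picked : ∀ p l → choice p ≡ just l → exchange l ≡ spine p
    exchange-picked p l c with valid p l c
    ... | leg , refl = exchange-chosen l leg c

    exchange-leg : ∀ l → ¬ OnSpine l →
                   exchange l ≡ l ⊎ (choice (foot l) ≡ just l × exchange l ≡ spine (foot l))
    exchange-leg l leg with chosen? l
    ... | yes c = inj₂ (c , exchange-chosen l leg c)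
    ... | no ¬c = inj₁ (exchange-unchosen l leg ¬c)

    exchange-matching : IsMatching G exchange
    exchange-matching = invol , adj
      where
        invol-spine : ∀ p → p < k → ∀ c → choice p ≡ c → exchange (fromMaybe (spine p) c) ≡ spine p
        invol-spine p h nothing  e = trans (exchange-spine p h) (cong (fromMaybe (spine p)) e)
        invol-spine p h (just l) e = exchange-picked p l e
        invol : ∀ v → exchange (exchange v) ≡ v
        invol v with onSpine? v
        ... | yes (p , h , refl) = invol-spine p h (choice p) refl
        ... | no  leg with chosen? v
        ...   | yes c = trans (exchange-spine (foot v) (foot< v)) (cong (fromMaybe _) c)
        ...   | no ¬c = exchange-unchosen v leg ¬c
        adj-spine : ∀ p c → choice p ≡ c → fromMaybe (spine p) c ≢ spine p →
                    Adj (spine p) (fromMaybe (spine p) c)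
        adj-spine p nothing  e moved = ⊥-elim (moved refl)
        adj-spine p (just l) e moved with valid p l e
        ... | leg , refl = Adj-sym (leg-adj l leg)
        adj : ∀ v → exchange v ≢ v → Adj v (exchange v)
        adj v moved with onSpine? v
        ... | yes (p , h , refl) = adj-spine p (choice p) refl moved
        ... | no  leg with chosen? v
        ...   | yes _ = leg-adj v leg
        ...   | no  _ = ⊥-elim (moved refl)

  zigzags : Bool → ℕ → List (Config n)
  zigzags b zero    = []
  zigzags b (suc T) = zig b ∷ zigzags (not b) T

  zigzags-matching : ∀ b T → All (IsMatching G) (zigzags b T)
  zigzags-matching b zero    = []
  zigzags-matching b (suc T) = zig-matching b ∷ zigzags-matching (not b) T

  length-zigzags : ∀ b T → length (zigzags b T) ≡ T
  length-zigzags b zero    = refl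
  length-zigzags b (suc T) = cong suc (length-zigzags (not b) T)

  zigzags-walker : ∀ T σ b w → Synced b w → position w < k →
                   run σ (zigzags b T) (spine (position (moves T w))) ≡ σ (spine (position w))
  zigzags-walker zero    σ b w s h = refl
  zigzags-walker (suc T) σ b w s h =
    trans (zigzags-walker T (σ ∘ zig b) (not b) (move w) (move-synced b w s) (move-< w h))
          (cong σ (zig-move b w s h))

  zigzags-leg : ∀ T σ b l → ¬ OnSpine l → run σ (zigzags b T) l ≡ σ l
  zigzags-leg zero    σ b l leg = refl
  zigzags-leg (suc T) σ b l leg = trans (zigzags-leg T (σ ∘ zig b) (not b) l leg) (cong σ (zig-leg b l leg))

  zigzags-during : ∀ {P : Config n → Set} t T σ b → t ≤ T →
                   P (run σ (zigzags b t)) → Any P (states G σ (zigzags b T))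
  zigzags-during zero    zero    σ b _         p = here p
  zigzags-during zero    (suc T) σ b _         p = here p
  zigzags-during (suc t) (suc T) σ b (s≤s t≤T) p = there (zigzags-during t T (σ ∘ zig b) (not b) t≤T p)

  lap : List (Config n)
  lap = zigzags true (k + k)

  -- During a lap the agent on spine q meets every other agent: the spine agents
  -- through walkers-meet, the leg agents when it passes their foot.
  lap-meets : ∀ σ q → q < k → ∀ w → σ w ≢ σ (spine q) → MeetDuring G σ lap (σ (spine q)) (σ w)
  lap-meets σ q q<k w ne with synced-heading true q | onSpine? w
  ... | d , s | yes (q′ , q′<k , refl) with synced-heading true q′
  ...   | d′ , s′ with walkers-meet true (d , q) (d′ , q′) s s′ q<k q′<k (ne ∘ cong (σ ∘ spine) ∘ sym)
  ...     | t , t<2k , adjacent = zigzags-during t (k + k) σ true (<⇒≤ t<2k)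
            (_ , _ , adjacent-spine _ _ (moves-< t _ q<k) (moves-< t _ q′<k) adjacent ,
             zigzags-walker t σ true (d , q) s q<k , zigzags-walker t σ true (d′ , q′) s′ q′<k)
  lap-meets σ q q<k w ne | d , s | no leg with visits (d , q) q<k (foot w) (foot< w)
  ...   | t , t<2k , e = zigzags-during t (k + k) σ true (<⇒≤ t<2k)
            (_ , w , Adj-sym (subst (λ z → Adj w (spine z)) (sym e) (leg-adj w leg)) ,
             zigzags-walker t σ true (d , q) s q<k , zigzags-leg t σ true w leg)

  module Loading (pending : Fin n → Bool) where

    PendingLeg : Config n → ℕ → Set
    PendingLeg σ j = ∃ λ l → ¬ OnSpine l × foot l ≡ j × pending (σ l) ≡ true

    pendingLeg? : ∀ σ j → Dec (PendingLeg σ j)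
    pendingLeg? σ j = any? λ l → ¬? (onSpine? l) ×-dec (foot l ℕ.≟ j ×-dec pending (σ l) Bool.≟ true)

    load : Config n → ℕ → Maybe (Fin n)
    load σ p with pending (σ (spine p)) | pendingLeg? σ p
    ... | true  | _           = nothing
    ... | false | yes (l , _) = just l
    ... | false | no  _       = nothing

    load-valid : ∀ σ → ValidChoice (load σ)
    load-valid σ p l e with pending (σ (spine p)) | pendingLeg? σ p | e
    ... | false | yes (l , leg , foot≡ , _) | refl = leg , foot≡

    load-just : ∀ σ p l → load σ p ≡ just l → pending (σ (spine p)) ≡ false × pending (σ l) ≡ true
    load-just σ p l e with pending (σ (spine p)) | pendingLeg? σ p | e
    ... | false | yes (l , _ , _ , fresh) | refl = refl , fresh

    load-nothing : ∀ σ p → pending (σ (spine p)) ≡ false → load σ p ≡ nothing → ¬ PendingLeg σ p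
    load-nothing σ p done e with pending (σ (spine p)) | pendingLeg? σ p | done | e
    ... | false | no none | refl | refl = none

    load-pending : ∀ σ p → pending (σ (spine p)) ≡ true → load σ p ≡ nothing
    load-pending σ p fresh with pending (σ (spine p)) | fresh
    ... | true | refl = refl

    refill : Config n → Fin n → Fin n
    refill σ = Exchange.exchange (load σ) (load-valid σ)

    refill-matching : ∀ σ → IsMatching G (refill σ)
    refill-matching σ = Exchange.exchange-matching (load σ) (load-valid σ)

    refill-spine : ∀ σ p → p < k → refill σ (spine p) ≡ fromMaybe (spine p) (load σ p)
    refill-spine σ = Exchange.exchange-spine (load σ) (load-valid σ)

    refill-pending : ∀ σ p → p < k → pending (σ (spine p)) ≡ true → σ (refill σ (spine p)) ≡ σ (spine p)
    refill-pending σ p h fresh =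
      cong σ (trans (refill-spine σ p h) (cong (fromMaybe (spine p)) (load-pending σ p fresh)))

    refill-outcome : ∀ σ p → p < k → pending (σ (refill σ (spine p))) ≡ true ⊎ ¬ PendingLeg σ p
    refill-outcome σ p h with pending (σ (spine p)) in fresh
    ... | true = inj₁ (trans (cong pending (refill-pending σ p h fresh)) fresh)
    ... | false with load σ p in e
    ...   | nothing = inj₂ (load-nothing σ p fresh e)
    ...   | just l  = inj₁ (trans (cong (pending ∘ σ) swapped) (proj₂ (load-just σ p l e)))
      where swapped = trans (refill-spine σ p h) (cong (fromMaybe (spine p)) e)

    zig-no-pendingLeg : ∀ σ b j → ¬ PendingLeg σ j → ¬ PendingLeg (σ ∘ zig b) j
    zig-no-pendingLeg σ b j none (l , leg , foot≡ , fresh) =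
      none (l , leg , foot≡ , trans (cong (pending ∘ σ) (sym (zig-leg b l leg))) fresh)

    refill-no-pendingLeg : ∀ σ j → ¬ PendingLeg σ j → ¬ PendingLeg (σ ∘ refill σ) j
    refill-no-pendingLeg σ j none (l , leg , foot≡ , fresh)
      with Exchange.exchange-leg (load σ) (load-valid σ) l leg
    ... | inj₁ e = none (l , leg , foot≡ , trans (cong (pending ∘ σ) (sym e)) fresh)
    ... | inj₂ (c , e) with load-just σ (foot l) l c
    ...   | done , _ with trans (sym (trans (cong (pending ∘ σ) (sym e)) fresh)) done
    ...     | ()

    loading : Config n → Bool → ℕ → List (Config n)
    loading σ b zero    = []
    loading σ b (suc T) = zig b ∷ refill τ ∷ loading (τ ∘ refill τ) (not b) T
      where τ = σ ∘ zig b

    loading-matching : ∀ σ b T → All (IsMatching G) (loading σ b T)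
    loading-matching σ b zero    = []
    loading-matching σ b (suc T) = zig-matching b ∷ refill-matching (σ ∘ zig b) ∷ loading-matching _ (not b) T

    length-loading : ∀ σ b T → length (loading σ b T) ≡ T + T
    length-loading σ b zero    = refl
    length-loading σ b (suc T) = cong suc (trans (cong suc (length-loading _ (not b) T)) (sym (+-suc T T)))

    loading-keeps-pending : ∀ T σ b w → Synced b w → position w < k →
                            pending (σ (spine (position w))) ≡ true →
                            pending (run σ (loading σ b T) (spine (position (moves T w)))) ≡ true
    loading-keeps-pending zero    σ b w s h fresh = fresh
    loading-keeps-pending (suc T) σ b w s h fresh =
      loading-keeps-pending T (τ ∘ refill τ) (not b) (move w) (move-synced b w s) (move-< w h)
        (trans (cong pending (refill-pending τ _ (move-< w h) fresh′)) fresh′)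
      where
        τ = σ ∘ zig b
        fresh′ : pending (τ (spine (position (move w)))) ≡ true
        fresh′ = trans (cong (pending ∘ σ) (zig-move b w s h)) fresh

    loading-no-pendingLeg : ∀ T σ b j → ¬ PendingLeg σ j → ¬ PendingLeg (run σ (loading σ b T)) j
    loading-no-pendingLeg zero    σ b j none = none
    loading-no-pendingLeg (suc T) σ b j none =
      loading-no-pendingLeg T _ (not b) j (refill-no-pendingLeg (σ ∘ zig b) j (zig-no-pendingLeg σ b j none))

    -- Until the walker carries a pending agent, every foot it passes has no pending
    -- leg afterwards: it would have taken one, and legs only receive settled agents.
    loading-walker : ∀ T σ b w → Synced b w → position w < k →
                     pending (run σ (loading σ b T) (spine (position (moves T w)))) ≡ true ⊎
                     (∀ t → t < T → ¬ PendingLeg (run σ (loading σ b T)) (position (moves (suc t) w)))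
    loading-walker zero    σ b w s h = inj₂ λ t ()
    loading-walker (suc T) σ b w s h with refill-outcome (σ ∘ zig b) (position (move w)) (move-< w h)
    ... | inj₁ fresh = inj₁ (loading-keeps-pending T _ (not b) (move w) (move-synced b w s) (move-< w h) fresh)
    ... | inj₂ none with loading-walker T _ (not b) (move w) (move-synced b w s) (move-< w h)
    ...   | inj₁ fresh  = inj₁ fresh
    ...   | inj₂ passed = inj₂ λ
      { zero    _         → loading-no-pendingLeg T _ (not b) _ (refill-no-pendingLeg (σ ∘ zig b) _ none)
      ; (suc t) (s≤s t<T) → passed t t<T }

  module Cycle (σ : Config n) (pending : Fin n → Bool) where
    open Loading pending

    -- Opaque, since unfolding the 2k loading rounds makes type checking very slow.
    opaque
      loaded : Config n
      loaded = run σ (loading σ true (k + k))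

      loaded-permutation : IsPermutation G σ → IsPermutation G loaded
      loaded-permutation = run-permutation G σ _ (loading-matching σ true (k + k))

      loaded-walker : ∀ w → Synced true w → position w < k →
                      pending (loaded (spine (position (moves (k + k) w)))) ≡ true ⊎
                      (∀ t → t < k + k → ¬ PendingLeg loaded (position (moves (suc t) w)))
      loaded-walker = loading-walker (k + k) σ true

      after-loading : ∀ {P : Config n → Set} ys → Any P (states G loaded ys) →
                      Any P (states G σ (loading σ true (k + k) ++ ys))
      after-loading = states-++⁺ʳ G σ (loading σ true (k + k))

    onSpineAfter : Fin n → Bool
    onSpineAfter = inImage (loaded ∘ spine) k

    SpineFull : Set
    SpineFull = ∀ q → q < k → pending (loaded (spine q)) ≡ true

    LegsEmpty : Set
    LegsEmpty = ∀ j → j < k → ¬ PendingLeg loaded j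

    pending′ : Fin n → Bool
    pending′ a = pending a ∧ not (onSpineAfter a)

    -- After a lap the walker from q is back at q, having passed every foot on the way.
    spine-pending-or-legs-empty : ∀ q → q < k → pending (loaded (spine q)) ≡ true ⊎ LegsEmpty
    spine-pending-or-legs-empty q h with synced-heading true q
    ... | d , s with loaded-walker (d , q) s h
    ...   | inj₁ fresh  =
      inj₁ (subst (λ w → pending (loaded (spine (position w))) ≡ true) (moves-period (d , q) h) fresh)
    ...   | inj₂ passed = inj₂ λ j j<k → empty j (visits (move (d , q)) (move-< (d , q) h) j j<k)
      where
        empty : ∀ j → (∃ λ t → t < k + k × position (moves (suc t) (d , q)) ≡ j) → ¬ PendingLeg loaded j
        empty j (t , t<2k , e) = subst (¬_ ∘ PendingLeg loaded) e (passed t t<2k)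

    spine-full-or-legs-empty : SpineFull ⊎ LegsEmpty
    spine-full-or-legs-empty with anyUpTo? (λ q → pending (loaded (spine q)) Bool.≟ false) k
    ... | no  none = inj₁ λ q h → ¬-not λ done → none (q , h , done)
    ... | yes (q , h , done) with spine-pending-or-legs-empty q h
    ...   | inj₂ empty = inj₂ empty
    ...   | inj₁ fresh with trans (sym fresh) done
    ...     | ()

    module _ (perm : IsPermutation G σ) where

      spine-full⇒count : SpineFull → count pending ≡ count pending′ + k
      spine-full⇒count full = trans (count-remove pending onSpineAfter onSpine⇒pending)
        (cong (count pending′ +_) (count-image (loaded ∘ spine) k injective))
        where
          injective : InjectiveBelow k (loaded ∘ spine)
          injective p<k q<k = spine-inj p<k q<k ∘ proj₁ (loaded-permutation perm)
          onSpine⇒pending : ∀ a → onSpineAfter a ≡ true → pending a ≡ true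
          onSpine⇒pending a on with inImage? (loaded ∘ spine) k a
          ... | yes (q , h , refl) = full q h

      legs-empty⇒count : LegsEmpty → count pending′ ≡ 0
      legs-empty⇒count empty = count-none pending′ settled
        where
          settled : ∀ a → pending′ a ≡ false
          settled a with inImage? (loaded ∘ spine) k a
          ... | yes _ = ∧-zeroʳ (pending a)
          ... | no off with proj₂ (loaded-permutation perm) a
          ...   | w , refl with onSpine? w
          ...     | yes (q , h , refl) = ⊥-elim (off (q , h , refl))
          ...     | no leg with pending (loaded w) in fresh
          ...       | true  = ⊥-elim (empty (foot w) (foot< w) (w , leg , refl , fresh))
          ...       | false = refl

      count-pending′≤ : ∀ c → count pending ≤ suc c * k → count pending′ ≤ c * k
      count-pending′≤ c bound with spine-full-or-legs-empty
      ... | inj₂ empty = subst (_≤ c * k) (sym (legs-empty⇒count empty)) z≤n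
      ... | inj₁ full  = +-cancelʳ-≤ k (count pending′) (c * k)
        (subst₂ _≤_ (spine-full⇒count full) (+-comm k (c * k)) bound)

      settled-meets : ∀ a → pending a ≡ true → pending′ a ≡ false → ∀ b → a ≢ b → MeetDuring G loaded lap a b
      settled-meets a fresh settled b a≢b with inImage? (loaded ∘ spine) k a
      ... | no _ rewrite fresh = case settled of λ ()
      ... | yes (q , h , refl) with proj₂ (loaded-permutation perm) b
      ...   | w , refl = lap-meets loaded q h w (a≢b ∘ sym)

  strategy : ℕ → Config n → (Fin n → Bool) → List (Config n)
  strategy zero    σ pending = []
  strategy (suc c) σ pending = loading σ true (k + k) ++ lap ++ strategy c (run loaded lap) pending′
    where
      open Loading pending
      open Cycle σ pending

  strategy-matching : ∀ c σ pending → All (IsMatching G) (strategy c σ pending)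
  strategy-matching zero    σ pending = []
  strategy-matching (suc c) σ pending =
    ++⁺ (loading-matching σ true (k + k)) (++⁺ (zigzags-matching true (k + k)) (strategy-matching c _ _))
    where open Loading pending

  length-strategy : ∀ c σ pending → length (strategy c σ pending) ≡ c * (6 * k)
  length-strategy zero    σ pending = refl
  length-strategy (suc c) σ pending = begin
    length (loading σ true (k + k) ++ lap ++ rest)
      ≡⟨ length-++ (loading σ true (k + k)) ⟩
    length (loading σ true (k + k)) + length (lap ++ rest)
      ≡⟨ cong₂ _+_ (length-loading σ true (k + k)) (length-++ lap) ⟩
    (k + k) + (k + k) + (length lap + length rest)
      ≡⟨ cong₂ (λ x y → (k + k) + (k + k) + (x + y)) (length-zigzags true (k + k)) (length-strategy c _ _) ⟩
    (k + k) + (k + k) + ((k + k) + c * (6 * k))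
      ≡⟨ cycle-length k c ⟩
    suc c * (6 * k)
      ∎
    where
      open ≡-Reasoning
      open Loading pending
      open Cycle σ pending
      rest = strategy c (run loaded lap) pending′
      cycle-length : ∀ k c → (k + k) + (k + k) + ((k + k) + c * (6 * k)) ≡ suc c * (6 * k)
      cycle-length = solve-∀

  strategy-meets : ∀ c σ pending → IsPermutation G σ → count pending ≤ c * k →
                   ∀ a → pending a ≡ true → ∀ b → a ≢ b → MeetDuring G σ (strategy c σ pending) a b
  strategy-meets zero    σ pending perm bound a fresh b a≢b =
    case trans (sym fresh) (count≡0⇒none pending (n≤0⇒n≡0 bound) a) of λ ()
  strategy-meets (suc c) σ pending perm bound a fresh b a≢b =
    after-loading (lap ++ rest) meets
    where
      open Loading pending
      open Cycle σ pending
      rest = strategy c (run loaded lap) pending′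
      meets : MeetDuring G loaded (lap ++ rest) a b
      meets with pending′ a in still
      ... | false = states-++⁺ˡ G loaded lap rest (settled-meets perm a fresh still b a≢b)
      ... | true  = states-++⁺ʳ G loaded lap rest
        (strategy-meets c (run loaded lap) pending′
          (run-permutation G loaded lap (zigzags-matching true (k + k)) (loaded-permutation perm))
          (count-pending′≤ perm c bound) a still b a≢b)

  ACAtMost-12n : ACAtMost G (12 * n)
  ACAtMost-12n = strategy cycles id (λ _ → true) , length-bound ,
    strategy-matching cycles id (λ _ → true) ,
    λ a b a≢b → strategy-meets cycles id (λ _ → true) (id-permutation G) pending-bound a refl b a≢b
    where
      cycles = suc (n / k)
      k≤n : k ≤ n
      k≤n = subst (_≤ n) (count-image spine k spine-inj) (count≤n (inImage spine k))
      pending-bound : count {n} (λ _ → true) ≤ cycles * k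
      pending-bound = ≤-trans (count≤n {n} (λ _ → true)) (begin
        n                    ≡⟨ m≡m%n+[m/n]*n n k ⟩
        n % k + n / k * k    ≤⟨ +-monoˡ-≤ (n / k * k) (<⇒≤ (m%n<n n k)) ⟩
        cycles * k           ∎)
        where open ≤-Reasoning
      length-bound : length (strategy cycles id (λ _ → true)) ≤ 12 * n
      length-bound = begin
        length (strategy cycles id (λ _ → true))  ≡⟨ length-strategy cycles id (λ _ → true) ⟩
        cycles * (6 * k)                          ≡⟨ distribute (n / k) k ⟩
        6 * k + 6 * (n / k * k)                   ≤⟨ +-mono-≤ (*-monoʳ-≤ 6 k≤n) (*-monoʳ-≤ 6 (m/n*n≤m n k)) ⟩
        6 * n + 6 * n                             ≡⟨ double n ⟩
        12 * n                                    ∎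
        where
          open ≤-Reasoning
          distribute : ∀ q k → suc q * (6 * k) ≡ 6 * k + 6 * (q * k)
          distribute = solve-∀
          double : ∀ n → 6 * n + 6 * n ≡ 12 * n
          double = solve-∀

nth : ∀ {A : Set} → A → List A → ℕ → A
nth d []       p       = d
nth d (x ∷ xs) zero    = x
nth d (x ∷ xs) (suc p) = nth d xs p

All-nth : ∀ {A : Set} {P : A → Set} d xs → All P xs → ∀ {p} → p < length xs → P (nth d xs p)
All-nth d (x ∷ xs) (px ∷ _)   {zero}  _         = px
All-nth d (x ∷ xs) (_  ∷ pxs) {suc p} (s≤s p<) = All-nth d xs pxs p<

Any-nth : ∀ {A : Set} {P : A → Set} d xs → Any P xs → ∃ λ p → p < length xs × P (nth d xs p)
Any-nth d (x ∷ xs) (here px) = zero , s≤s z≤n , px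
Any-nth d (x ∷ xs) (there pxs) with Any-nth d xs pxs
... | p , p< , px = suc p , s≤s p< , px

nth-injective : ∀ {A : Set} d (xs : List A) → AllPairs _≢_ xs → InjectiveBelow (length xs) (nth d xs)
nth-injective d (x ∷ xs) (_ ∷ _)    {zero}  {zero}  _        _        _ = refl
nth-injective d (x ∷ xs) (x∉ ∷ _)   {zero}  {suc q} _        (s≤s q<) e = contradiction e (All-nth d xs x∉ q<)
nth-injective d (x ∷ xs) (x∉ ∷ _)   {suc p} {zero}  (s≤s p<) _        e = contradiction (sym e) (All-nth d xs x∉ p<)
nth-injective d (x ∷ xs) (_ ∷ uniq) {suc p} {suc q} (s≤s p<) (s≤s q<) e =
  cong suc (nth-injective d xs uniq p< q< e)

nth-chain : ∀ {n} (G : Graph n) d xs → Chain G xs →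
            ∀ {p} → suc p < length xs → Graph.Adj G (nth d xs p) (nth d xs (suc p))
nth-chain G d (x ∷ [])     _            {zero}  (s≤s ())
nth-chain G d (x ∷ y ∷ xs) (xy , _)     {zero}  _         = xy
nth-chain G d (x ∷ y ∷ xs) (_  , chain) {suc p} (s≤s p<) = nth-chain G d (y ∷ xs) chain p<

caterpillar-ACAtMost-12n : ∀ {n} (T : Graph n) → IsCaterpillar T → ACAtMost T (12 * n)
caterpillar-ACAtMost-12n T (_ , [] , _ , dominated) = [] , z≤n , [] , λ a _ _ → case dominated a of λ ()
caterpillar-ACAtMost-12n T (_ , x ∷ xs , (unique , chain) , dominated) =
  Caterpillar.ACAtMost-12n T (length xs) (nth x (x ∷ xs)) (nth-chain T x (x ∷ xs) chain)
    (nth-injective x (x ∷ xs) unique) (λ v → Any-nth x (x ∷ xs) (dominated v))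

proposition3p4 : Σ ℕ λ C → 0 < C × ((n : ℕ) (T : Graph n) → IsCaterpillar T → ACAtMost T (C * n))
proposition3p4 = 12 , s≤s z≤n , λ n → caterpillar-ACAtMost-12n
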